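{- Let $P$ be a well-formed program of Core Choreographies, $s$ a state, $\vec\lambda$ a list of observable labels and $c'=(P',s')$ a configuration with $(P,s)\xrightarrow{\vec\lambda}{}^{*}c'$. Then either the main choreography of $P'$ is $\mathsf{end}$, or there exist an observable label $\lambda$ and a configuration $c''$ with $c'\xrightarrow{\lambda}c''$.
   Context: Fix types with decidable equality of process names $\mathsf{Pid}$, variables $\mathsf{Var}$, values $\mathsf{Val}$, expressions, Boolean expressions, procedure names $\mathsf{RecVar}$, annotations, and evaluation functions $\mathrm{eval}$ (expression and local state $\mathsf{Var}\to\mathsf{Val}$ to value) and $\mathrm{beval}$ (Boolean expression and local state to Boolean), invariant under extensional equality of local states. Labels: $\mathsf{left},\mathsf{right}$. A state is $s:\mathsf{Pid}\to\mathsf{Var}\to\mathsf{Val}$; $s\equiv s'$ is extensional equality; $s[q,x\mapsto v]$ is update. Interactions $\eta::=p.e\to q.x\mid p\to q[l]$ (processes $\{p,q\}$); choreographies $C::=\eta@a;C\mid\mathsf{if}\ p.b\ \mathsf{then}\ C_1\ \mathsf{else}\ C_2\mid\mathsf{call}\ X\mid\mathsf{rtcall}\ X\ ps\ C\mid\mathsf{end}$, $ps$ a list of processes. $D:\mathsf{RecVar}\to\mathrm{list}(\mathsf{Pid})\times\mathsf{Chor}$, $D\,X=(\mathrm{Vars}\,X,\mathrm{Body}\,X)$; a program is $(D,C)$ ($C$ is its main choreography), a configuration is a pair (program, state). Rich labels $\mathrm{com}(p,v,q,x),\mathrm{sel}(p,q,l),\mathrm{cond}(p),\mathrm{call}(X,p)$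 with processes $\{p,q\},\{p,q\},\{p\},\{p\}$. $\langle C,s\rangle\xrightarrow{\rho}_D\langle C',s'\rangle$ is the least relation with: $\langle p.e\to q.x@a;C,s\rangle\xrightarrow{\mathrm{com}(p,v,q,x)}\langle C,s'\rangle$ if $v=\mathrm{eval}(e,s\,p)$, $s'\equiv s[q,x\mapsto v]$; $\langle p\to q[l]@a;C,s\rangle\xrightarrow{\mathrm{sel}(p,q,l)}\langle C,s'\rangle$ if $s\equiv s'$; $\langle\mathsf{if}\ p.b\ \mathsf{then}\ C_1\ \mathsf{else}\ C_2,s\rangle\xrightarrow{\mathrm{cond}(p)}\langle C_1,s'\rangle$ (resp. $C_2$) if $\mathrm{beval}(b,s\,p)$ is true (resp. false), $s\equiv s'$; $\langle\eta@a;C,s\rangle\xrightarrow{\rho}\langle\eta@a;C',s'\rangle$ if $\langle C,s\rangle\xrightarrow{\rho}\langle C',s'\rangle$ and processes of $\eta$, $\rho$ are disjoint; $\langle\mathsf{if}\ p.b\ \mathsf{then}\ C_1\ \mathsf{else}\ C_2,s\rangle\xrightarrow{\rho}\langle\mathsf{if}\ p.b\ \mathsf{then}\ C_1'\ \mathsf{else}\ C_2',s'\rangle$ if $p$ not in $\rho$ and $\langle C_i,s\rangle\xrightarrow{\rho}\langle C_i',s'\rangle$, $i=1,2$; $\langle\mathsf{rtcall}\ X\ ps\ C,s\rangle\xrightarrow{\rho}\langle\mathsf{rtcall}\ X\ ps\ C',s'\rangle$ if no process of $\rho$ is in $ps$ and $\langle C,s\rangle\xrightarrow{\rho}\langle C',s'\rangle$;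 for $s\equiv s'$, $p\in\mathrm{Vars}\,X$: $\langle\mathsf{call}\ X,s\rangle\xrightarrow{\mathrm{call}(X,p)}\langle\mathrm{Body}\,X,s'\rangle$ if $\#\mathrm{Vars}\,X=1$, and $\langle\mathsf{rtcall}\ X\ (\mathrm{Vars}\,X\setminus p)\ (\mathrm{Body}\,X),s'\rangle$ if $\#\mathrm{Vars}\,X>1$; for $s\equiv s'$, $p\in ps$: $\langle\mathsf{rtcall}\ X\ ps\ C,s\rangle\xrightarrow{\mathrm{call}(X,p)}\langle\mathsf{rtcall}\ X\ (ps\setminus p)\ C,s'\rangle$ if $\#ps>1$ and $\langle C,s'\rangle$ if $\#ps=1$ ($\#$ is list size, $\setminus p$ removes $p$). Observable labels: $\mathrm{forget}(\mathrm{com}(p,v,q,x))=\mathrm{com}(p,v,q)$, $\mathrm{forget}(\mathrm{sel}(p,q,l))=\mathrm{sel}(p,q,l)$, $\mathrm{forget}(\mathrm{cond}(p))=\mathrm{forget}(\mathrm{call}(X,p))=\tau(p)$; $((D,C),s)\xrightarrow{\mathrm{forget}(\rho)}((D,C'),s')$ iff $\langle C,s\rangle\xrightarrow{\rho}_D\langle C',s'\rangle$. Multi-step: $(P,s)\xrightarrow{[\,]}{}^{*}(P,s')$ whenever $s\equiv s'$, and $c_1\xrightarrow{\lambda::\vec\lambda}{}^{*}c_3$ if $c_1\xrightarrow{\lambda}c_2$ and $c_2\xrightarrow{\vec\lambda}{}^{*}c_3$. Well-formedness of $(D,C)$: $C$ contains no self-interaction ($p.e\to p.x$ or $p\to p[l]$),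 every $\mathsf{rtcall}\ X\ ps\ C'$ in $C$ has $ps$ nonempty with $ps\subseteq\mathrm{Vars}\,X$; for every $X$, $\mathrm{Body}\,X$ contains no self-interaction and no $\mathsf{rtcall}$, $\mathrm{Vars}\,X$ is nonempty, and every process occurring in $\mathrm{Body}\,X$ (counting, for each $\mathsf{call}\ Y$ in it, the processes of $\mathrm{Vars}\,Y$) is in $\mathrm{Vars}\,X$. -}

module Defs where

open import Data.Bool using (Bool; true; false; if_then_else_)
open import Data.Nat using (ℕ; _>_)
open import Data.List using (List; []; _∷_; length; _++_)
open import Data.List.Membership.Propositional using (_∈_; _∉_)
open import Data.List.Relation.Binary.Subset.Propositional using (_⊆_)
open import Data.Product using (_×_; _,_; proj₁; proj₂)
open import Data.Unit using (⊤)
open import Data.Empty using (⊥)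
open import Relation.Binary.Definitions using (DecidableEquality)
open import Relation.Binary.PropositionalEquality using (_≡_; _≢_)
open import Relation.Nullary using (yes; no; ¬_)

record Sig : Set₁ where
  field
    Pid RecVar Var Val Expr BExpr Ann : Set
    _≟Pid_    : DecidableEquality Pid
    _≟Var_    : DecidableEquality Var
    _≟Val_    : DecidableEquality Val
    _≟Expr_   : DecidableEquality Expr
    _≟BExpr_  : DecidableEquality BExpr
    _≟RecVar_ : DecidableEquality RecVar
    _≟Ann_    : DecidableEquality Ann
    eval  : Expr  → (Var → Val) → Val
    beval : BExpr → (Var → Val) → Bool
    eval-ext  : ∀ e {f g : Var → Val} → (∀ x → f x ≡ g x) → eval e f ≡ eval e g
    beval-ext : ∀ b {f g : Var → Val} → (∀ x → f x ≡ g x) → beval b f ≡ beval b g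

data SelLabel : Set where
  left right : SelLabel

module Core (S : Sig) where
  open Sig S

  _∖_ : List Pid → Pid → List Pid
  [] ∖ p = []
  (q ∷ qs) ∖ p with q ≟Pid p
  ... | yes _ = qs
  ... | no  _ = q ∷ (qs ∖ p)

  State : Set
  State = Pid → Var → Val

  _≐_ : State → State → Set
  s ≐ s' = ∀ p x → s p x ≡ s' p x

  _[_,_↦_] : State → Pid → Var → Val → State
  (s [ q , x ↦ v ]) r y with r ≟Pid q | y ≟Var x
  ... | yes _ | yes _ = v
  ... | _     | _     = s r y

  data Interaction : Set where
    com : Pid → Expr → Pid → Var → Interaction
    sel : Pid → Pid → SelLabel → Interaction

  pnI : Interaction → List Pid
  pnI (com p e q x) = p ∷ q ∷ []
  pnI (sel p q l)   = p ∷ q ∷ []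

  data Chor : Set where
    _at_⨾_  : Interaction → Ann → Chor → Chor
    If_·_then_else_ : Pid → BExpr → Chor → Chor → Chor
    call   : RecVar → Chor
    rtcall : RecVar → List Pid → Chor → Chor
    end    : Chor

  Procs : Set
  Procs = RecVar → List Pid × Chor

  Vars : Procs → RecVar → List Pid
  Vars D X = proj₁ (D X)

  Body : Procs → RecVar → Chor
  Body D X = proj₂ (D X)

  Program : Set
  Program = Procs × Chor

  main : Program → Chor
  main = proj₂

  Config : Set
  Config = Program × State

  data RLabel : Set where
    rcom  : Pid → Val → Pid → Var → RLabel
    rsel  : Pid → Pid → SelLabel → RLabel
    rcond : Pid → RLabel
    rcall : RecVar → Pid → RLabel

  pnR : RLabel → List Pid
  pnR (rcom p v q x) = p ∷ q ∷ []
  pnR (rsel p q l)   = p ∷ q ∷ []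
  pnR (rcond p)      = p ∷ []
  pnR (rcall X p)    = p ∷ []

  data OLabel : Set where
    ocom : Pid → Val → Pid → OLabel
    osel : Pid → Pid → SelLabel → OLabel
    τ    : Pid → OLabel

  forget : RLabel → OLabel
  forget (rcom p v q x) = ocom p v q
  forget (rsel p q l)   = osel p q l
  forget (rcond p)      = τ p
  forget (rcall X p)    = τ p

  data Step (D : Procs) : Chor → State → RLabel → Chor → State → Set where
    s-com : ∀ {p e q x a C s s' v} → v ≡ eval e (s p) → s' ≐ (s [ q , x ↦ v ]) →
            Step D (com p e q x at a ⨾ C) s (rcom p v q x) C s'
    s-sel : ∀ {p q l a C s s'} → s ≐ s' →
            Step D (sel p q l at a ⨾ C) s (rsel p q l) C s'
    s-then : ∀ {p b C₁ C₂ s s'} → beval b (s p) ≡ true → s ≐ s' →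
             Step D (If p · b then C₁ else C₂) s (rcond p) C₁ s'
    s-else : ∀ {p b C₁ C₂ s s'} → beval b (s p) ≡ false → s ≐ s' →
             Step D (If p · b then C₁ else C₂) s (rcond p) C₂ s'
    s-delay-η : ∀ {η a C C' s s' ρ} → (∀ r → r ∈ pnI η → r ∉ pnR ρ) →
             Step D C s ρ C' s' →
             Step D (η at a ⨾ C) s ρ (η at a ⨾ C') s'
    s-delay-if : ∀ {p b C₁ C₂ C₁' C₂' s s' ρ} → p ∉ pnR ρ →
             Step D C₁ s ρ C₁' s' → Step D C₂ s ρ C₂' s' →
             Step D (If p · b then C₁ else C₂) s ρ (If p · b then C₁' else C₂') s'
    s-delay-rt : ∀ {X ps C C' s s' ρ} → (∀ r → r ∈ pnR ρ → r ∉ ps) →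
             Step D C s ρ C' s' →
             Step D (rtcall X ps C) s ρ (rtcall X ps C') s'
    s-call-end : ∀ {X p s s'} → s ≐ s' → p ∈ Vars D X → length (Vars D X) ≡ 1 →
             Step D (call X) s (rcall X p) (Body D X) s'
    s-call-start : ∀ {X p s s'} → s ≐ s' → p ∈ Vars D X → length (Vars D X) > 1 →
             Step D (call X) s (rcall X p) (rtcall X (Vars D X ∖ p) (Body D X)) s'
    s-rtcall : ∀ {X ps C p s s'} → s ≐ s' → p ∈ ps → length ps > 1 →
             Step D (rtcall X ps C) s (rcall X p) (rtcall X (ps ∖ p) C) s'
    s-rtcall-end : ∀ {X ps C p s s'} → s ≐ s' → p ∈ ps → length ps ≡ 1 →
             Step D (rtcall X ps C) s (rcall X p) C s'

  data _─⟨_⟩→_ : Config → OLabel → Config → Set where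
    cstep : ∀ {D C C' s s' ρ} → Step D C s ρ C' s' →
            ((D , C) , s) ─⟨ forget ρ ⟩→ ((D , C') , s')

  data _─⟨_⟩→*_ : Config → List OLabel → Config → Set where
    ms-refl : ∀ {P s s'} → s ≐ s' → (P , s) ─⟨ [] ⟩→* (P , s')
    ms-step : ∀ {c₁ c₂ c₃ l ls} → c₁ ─⟨ l ⟩→ c₂ → c₂ ─⟨ ls ⟩→* c₃ →
              c₁ ─⟨ l ∷ ls ⟩→* c₃

  NoSelfI : Interaction → Set
  NoSelfI (com p e q x) = p ≢ q
  NoSelfI (sel p q l)   = p ≢ q

  NoSelf : Chor → Set
  NoSelf (η at a ⨾ C)              = NoSelfI η × NoSelf C
  NoSelf (If p · b then C₁ else C₂) = NoSelf C₁ × NoSelf C₂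
  NoSelf (call X)                = ⊤
  NoSelf (rtcall X ps C)         = NoSelf C
  NoSelf end                     = ⊤

  RTOk : Procs → Chor → Set
  RTOk D (η at a ⨾ C)              = RTOk D C
  RTOk D (If p · b then C₁ else C₂) = RTOk D C₁ × RTOk D C₂
  RTOk D (call X)                = ⊤
  RTOk D (rtcall X ps C)         = (ps ≢ []) × (ps ⊆ Vars D X) × RTOk D C
  RTOk D end                     = ⊤

  NoRT : Chor → Set
  NoRT (η at a ⨾ C)              = NoRT C
  NoRT (If p · b then C₁ else C₂) = NoRT C₁ × NoRT C₂
  NoRT (call X)                = ⊤
  NoRT (rtcall X ps C)         = ⊥
  NoRT end                     = ⊤

  procs : Procs → Chor → List Pid
  procs D (η at a ⨾ C)              = pnI η ++ procs D C
  procs D (If p · b then C₁ else C₂) = p ∷ (procs D C₁ ++ procs D C₂)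
  procs D (call Y)                = Vars D Y
  procs D (rtcall Y ps C)         = ps ++ procs D C
  procs D end                     = []

  WellFormed : Program → Set
  WellFormed (D , C) =
    NoSelf C × RTOk D C ×
    (∀ X → NoSelf (Body D X) × NoRT (Body D X) × (Vars D X ≢ []) ×
           (procs D (Body D X) ⊆ Vars D X))

-- Core Choreographies enjoy progress: a configuration whose main choreography
-- is not end can always step, provided every runtime call still waits for
-- some process.  Well-formedness guarantees this invariant initially, and it
-- is preserved by steps because procedure bodies contain no runtime calls and
-- have nonempty parameter lists, while the processes of a runtime call are
-- only removed one at a time from a list of length at least two.
module Submission where

open import Defs
open import Data.List using (List; []; _∷_; length)
open import Data.List.Relation.Unary.Any using (here)
open import Data.List.Membership.Propositional using (_∈_)
open import Data.Product using (Σ; ∃; _×_; _,_; proj₁; proj₂)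
open import Data.Sum using (_⊎_; inj₁; inj₂)
open import Data.Bool using (true; false)
open import Data.Nat using (_>_; s≤s; z≤n)
open import Data.Empty using (⊥-elim)
open import Data.Unit using (⊤; tt)
open import Relation.Nullary using (yes; no)
open import Relation.Binary.PropositionalEquality using (_≡_; _≢_; refl)

nonempty⇒∃∈ : ∀ {A : Set} {xs : List A} → xs ≢ [] → ∃ (_∈ xs)
nonempty⇒∃∈ {xs = []}     xs≢[] = ⊥-elim (xs≢[] refl)
nonempty⇒∃∈ {xs = x ∷ xs} _     = x , here refl

nonempty⇒length≡1⊎length>1 : ∀ {A : Set} {xs : List A} → xs ≢ [] →
                             length xs ≡ 1 ⊎ length xs > 1
nonempty⇒length≡1⊎length>1 {xs = []}         xs≢[] = ⊥-elim (xs≢[] refl)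
nonempty⇒length≡1⊎length>1 {xs = _ ∷ []}     _     = inj₁ refl
nonempty⇒length≡1⊎length>1 {xs = _ ∷ _ ∷ _}  _     = inj₂ (s≤s (s≤s z≤n))

module _ (S : Sig) where
  open Sig S
  open Core S

  NonemptyRtcalls : Chor → Set
  NonemptyRtcalls (η at a ⨾ C)               = NonemptyRtcalls C
  NonemptyRtcalls (If p · b then C₁ else C₂) = NonemptyRtcalls C₁ × NonemptyRtcalls C₂
  NonemptyRtcalls (call X)                   = ⊤
  NonemptyRtcalls (rtcall X ps C)            = ps ≢ [] × NonemptyRtcalls C
  NonemptyRtcalls end                        = ⊤

  RTOk⇒NonemptyRtcalls : ∀ {D} C → RTOk D C → NonemptyRtcalls C
  RTOk⇒NonemptyRtcalls (η at a ⨾ C)               ok         = RTOk⇒NonemptyRtcalls C ok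
  RTOk⇒NonemptyRtcalls (If p · b then C₁ else C₂) (ok₁ , ok₂) =
    RTOk⇒NonemptyRtcalls C₁ ok₁ , RTOk⇒NonemptyRtcalls C₂ ok₂
  RTOk⇒NonemptyRtcalls (call X)                   _          = tt
  RTOk⇒NonemptyRtcalls (rtcall X ps C)            (ps≢[] , _ , ok) =
    ps≢[] , RTOk⇒NonemptyRtcalls C ok
  RTOk⇒NonemptyRtcalls end                        _          = tt

  NoRT⇒NonemptyRtcalls : ∀ C → NoRT C → NonemptyRtcalls C
  NoRT⇒NonemptyRtcalls (η at a ⨾ C)               noRT          = NoRT⇒NonemptyRtcalls C noRT
  NoRT⇒NonemptyRtcalls (If p · b then C₁ else C₂) (noRT₁ , noRT₂) =
    NoRT⇒NonemptyRtcalls C₁ noRT₁ , NoRT⇒NonemptyRtcalls C₂ noRT₂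
  NoRT⇒NonemptyRtcalls (call X)                   _             = tt
  NoRT⇒NonemptyRtcalls end                        _             = tt

  length>1⇒∖-nonempty : ∀ xs p → length xs > 1 → xs ∖ p ≢ []
  length>1⇒∖-nonempty (_ ∷ []) _ (s≤s ())
  length>1⇒∖-nonempty (q ∷ q′ ∷ qs) p _ with q ≟Pid p
  ... | yes _ = λ ()
  ... | no  _ = λ ()

  ProceduresOk : Procs → Set
  ProceduresOk D = ∀ X → NoRT (Body D X) × Vars D X ≢ []

  WellFormed⇒ProceduresOk : ∀ P → WellFormed P → ProceduresOk (proj₁ P)
  WellFormed⇒ProceduresOk _ (_ , _ , procsWF) X =
    let (_ , noRT , vars≢[] , _) = procsWF X in noRT , vars≢[]

  module _ {D : Procs} (D-ok : ProceduresOk D) where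

    Body-NonemptyRtcalls : ∀ X → NonemptyRtcalls (Body D X)
    Body-NonemptyRtcalls X = NoRT⇒NonemptyRtcalls (Body D X) (proj₁ (D-ok X))

    step-preserves-NonemptyRtcalls : ∀ {C s ρ C′ s′} → Step D C s ρ C′ s′ →
                                     NonemptyRtcalls C → NonemptyRtcalls C′
    step-preserves-NonemptyRtcalls (s-com _ _)  ne = ne
    step-preserves-NonemptyRtcalls (s-sel _)    ne = ne
    step-preserves-NonemptyRtcalls (s-then _ _) (ne₁ , _) = ne₁
    step-preserves-NonemptyRtcalls (s-else _ _) (_ , ne₂) = ne₂
    step-preserves-NonemptyRtcalls (s-delay-η _ st) ne = step-preserves-NonemptyRtcalls st ne
    step-preserves-NonemptyRtcalls (s-delay-if _ st₁ st₂) (ne₁ , ne₂) =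
      step-preserves-NonemptyRtcalls st₁ ne₁ , step-preserves-NonemptyRtcalls st₂ ne₂
    step-preserves-NonemptyRtcalls (s-delay-rt _ st) (ps≢[] , ne) =
      ps≢[] , step-preserves-NonemptyRtcalls st ne
    step-preserves-NonemptyRtcalls (s-call-end {X = X} _ _ _) _ = Body-NonemptyRtcalls X
    step-preserves-NonemptyRtcalls (s-call-start {X = X} {p = p} _ _ >1) _ =
      length>1⇒∖-nonempty (Vars D X) p >1 , Body-NonemptyRtcalls X
    step-preserves-NonemptyRtcalls (s-rtcall {ps = ps} {p = p} _ _ >1) (_ , ne) =
      length>1⇒∖-nonempty ps p >1 , ne
    step-preserves-NonemptyRtcalls (s-rtcall-end _ _ _) (_ , ne) = ne

    multistep-preserves-NonemptyRtcalls :
      ∀ {C s ls c′} → NonemptyRtcalls C → ((D , C) , s) ─⟨ ls ⟩→* c′ →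
      Σ Chor λ C′ → Σ State λ s′ → c′ ≡ ((D , C′) , s′) × NonemptyRtcalls C′
    multistep-preserves-NonemptyRtcalls ne (ms-refl _) = _ , _ , refl , ne
    multistep-preserves-NonemptyRtcalls ne (ms-step (cstep st) rest) =
      multistep-preserves-NonemptyRtcalls (step-preserves-NonemptyRtcalls st ne) rest

    ≐-refl : ∀ {s} → s ≐ s
    ≐-refl _ _ = refl

    progress : ∀ C s → NonemptyRtcalls C →
               C ≡ end ⊎ Σ OLabel (λ l → Σ Config (λ c″ → ((D , C) , s) ─⟨ l ⟩→ c″))
    progress (com p e q x at a ⨾ C) s _ =
      inj₂ (_ , _ , cstep (s-com {s' = s [ q , x ↦ eval e (s p) ]} refl ≐-refl))
    progress (sel p q l at a ⨾ C) s _ = inj₂ (_ , _ , cstep (s-sel {s' = s} ≐-refl))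
    progress (If p · b then C₁ else C₂) s _ with beval b (s p) in eq
    ... | true  = inj₂ (_ , _ , cstep (s-then {s' = s} eq ≐-refl))
    ... | false = inj₂ (_ , _ , cstep (s-else {s' = s} eq ≐-refl))
    progress (call X) s _
      with nonempty⇒∃∈ (proj₂ (D-ok X)) | nonempty⇒length≡1⊎length>1 (proj₂ (D-ok X))
    ... | p , p∈ | inj₁ ≡1 = inj₂ (_ , _ , cstep (s-call-end {p = p} {s' = s} ≐-refl p∈ ≡1))
    ... | p , p∈ | inj₂ >1 = inj₂ (_ , _ , cstep (s-call-start {p = p} {s' = s} ≐-refl p∈ >1))
    progress (rtcall X ps C) s (ps≢[] , _)
      with nonempty⇒∃∈ ps≢[] | nonempty⇒length≡1⊎length>1 ps≢[]
    ... | p , p∈ | inj₁ ≡1 =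
      inj₂ (_ , _ , cstep (s-rtcall-end {X = X} {C = C} {s' = s} ≐-refl p∈ ≡1))
    ... | p , p∈ | inj₂ >1 =
      inj₂ (_ , _ , cstep (s-rtcall {X = X} {C = C} {s' = s} ≐-refl p∈ >1))
    progress end s _ = inj₁ refl

mainTheorem4 : (S : Sig) → let open Core S in
    ∀ (P : Program) (s : State) (ls : List OLabel) (c' : Config) →
    WellFormed P → (P , s) ─⟨ ls ⟩→* c' →
    main (proj₁ c') ≡ end ⊎ Σ OLabel (λ l → Σ Config (λ c'' → c' ─⟨ l ⟩→ c''))
mainTheorem4 S P@(D , C) s ls c' wf@(_ , rtOk , _) steps
  with multistep-preserves-NonemptyRtcalls S (WellFormed⇒ProceduresOk S P wf)
         (RTOk⇒NonemptyRtcalls S C rtOk) steps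
... | C′ , s′ , refl , ne = progress S (WellFormed⇒ProceduresOk S P wf) C′ s′ ne
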